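{- Let $R(\mathbf{x},\mathbf{x}')$ be a balanced difference bounds constraint over $N$ variables and let $\rho$ be a path in an unfolding of $\mathcal{G}_R$ having at least one subpath that is an lb-corner. Then there exist subpaths $\rho_1,\theta,\rho_2$ of $\rho$ such that $\rho=\rho_1.\theta.\rho_2$, the only subpath of $\rho_1.\theta$ that is an lb-corner is $\theta$ itself (as that occurrence), and $\theta$ has extent $N^2+1$.
   Context: Variables range over $\mathbb{Z}$; $\mathbf{x}=\{x_1,\dots,x_N\}$. A difference bounds constraint is a finite conjunction of atoms $u-v\le c$, $c\in\mathbb{Z}$, with constraint graph having an edge $u\xrightarrow{c}v$ per atom. $R$ is balanced if $x_i-x_j\le c$ is an atom of $R$ iff $x_i'-x_j'\le c$ is. With fresh copies $x_i^{(p)}$, $p\in\mathbb{Z}$ (position $p$), an unfolding of $\mathcal{G}_R$ is the union over consecutive $p$ of the constraint graphs of $R(\mathbf{x}^{(p)},\mathbf{x}^{(p+1)})$ (either $p=0,\dots,n-1$ or all $p\in\mathbb{Z}$). Paths, contiguous subpaths, concatenation $.$ and $\mathrm{positions}$ are as usual. A corner is a path $x_{i_0}^{(k_0)}\to\cdots\to x_{i_m}^{(k_m)}$, $m\ge1$, with $k_0=k_m$; it is a right corner of extent $d$ if its positions are $\{k_0,\dots,k_0+d\}$ and a left corner of extent $d$ if they are $\{k_0-d,\dots,k_0\}$; it is basic if $k_0\notin\{k_1,\dots,k_{m-1}\}$, long if $d>N^2$, and an lb-corner if long and basic. -}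

module Defs where

open import Data.Nat as ℕ using (ℕ; suc)
open import Data.Integer as ℤ using (ℤ; +_)
open import Data.Fin using (Fin)
open import Data.Bool using (Bool; true; false)
open import Data.List using (List)
open import Data.List.Membership.Propositional using (_∈_)
open import Data.Product using (Σ; ∃; _×_; _,_; proj₁; proj₂)
open import Data.Sum using (_⊎_)
open import Relation.Binary.PropositionalEquality using (_≡_; _≢_)
open import Function.Bundles using (_⇔_)

-- Difference bounds constraints R(x, x') over N variables.
-- A term is x_i (primed = false) or x_i' (primed = true).

Term : ℕ → Set
Term N = Fin N × Bool

-- The atom  u - v ≤ c .
record Atom (N : ℕ) : Set where
  constructor atom
  field
    lhs   : Term N
    rhs   : Term N
    bound : ℤ
open Atom public

DBC : ℕ → Set
DBC N = List (Atom N)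

Balanced : ∀ {N} → DBC N → Set
Balanced {N} R = (i j : Fin N) (c : ℤ) →
  (atom (i , false) (j , false) c ∈ R) ⇔ (atom (i , true) (j , true) c ∈ R)

-- Unfoldings of G_R: vertices x_i^(p), p ∈ ℤ.

Vertex : ℕ → Set
Vertex N = Fin N × ℤ

position : ∀ {N} → Vertex N → ℤ
position = proj₂

-- Which copies R(x^(p), x^(p+1)) are used: p = 0..n-1, or all p ∈ ℤ.
data Unfolding : Set where
  finite   : ℕ → Unfolding
  infinite : Unfolding

Active : Unfolding → ℤ → Set
Active (finite n) p = (+ 0 ℤ.≤ p) × (p ℤ.< + n)
Active infinite   p = p ≡ p

place : ∀ {N} → Term N → ℤ → Vertex N
place (i , false) p = (i , p)
place (i , true)  p = (i , p ℤ.+ + 1)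

Edge : ∀ {N} → Unfolding → DBC N → Vertex N → ℤ → Vertex N → Set
Edge U R u c v = ∃ λ p → Active U p × ∃ λ a → a ∈ R ×
  (place (lhs a) p ≡ u) × (place (rhs a) p ≡ v) × (bound a ≡ c)

-- A path v_0 → v_1 → ... → v_len in the unfolding (vertex values at
-- indices > len are irrelevant), with a chosen edge for each step.
record Path {N} (U : Unfolding) (R : DBC N) : Set where
  field
    len    : ℕ
    vert   : ℕ → Vertex N
    weight : ℕ → ℤ
    step   : ∀ i → i ℕ.< len → Edge U R (vert i) (weight i) (vert (suc i))
open Path public

pos : ∀ {N U} {R : DBC N} → Path U R → ℕ → ℤ
pos ρ j = position (vert ρ j)

-- Subpaths of ρ are the contiguous pieces v_a → ... → v_b, a ≤ b ≤ len.
-- Corners are subpaths with a < b (m ≥ 1) and k_0 = k_m.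

IsCorner : ∀ {N U} {R : DBC N} → Path U R → ℕ → ℕ → Set
IsCorner ρ a b = (a ℕ.< b) × (b ℕ.≤ len ρ) × (pos ρ a ≡ pos ρ b)

InPositions : ∀ {N U} {R : DBC N} → Path U R → ℕ → ℕ → ℤ → Set
InPositions ρ a b k = ∃ λ j → (a ℕ.≤ j) × (j ℕ.≤ b) × (pos ρ j ≡ k)

RightCorner : ∀ {N U} {R : DBC N} → Path U R → ℕ → ℕ → ℕ → Set
RightCorner ρ a b d = IsCorner ρ a b × ((k : ℤ) →
  InPositions ρ a b k ⇔ ((pos ρ a ℤ.≤ k) × (k ℤ.≤ pos ρ a ℤ.+ + d)))

LeftCorner : ∀ {N U} {R : DBC N} → Path U R → ℕ → ℕ → ℕ → Set
LeftCorner ρ a b d = IsCorner ρ a b × ((k : ℤ) →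
  InPositions ρ a b k ⇔ ((pos ρ a ℤ.- + d ℤ.≤ k) × (k ℤ.≤ pos ρ a)))

HasExtent : ∀ {N U} {R : DBC N} → Path U R → ℕ → ℕ → ℕ → Set
HasExtent ρ a b d = RightCorner ρ a b d ⊎ LeftCorner ρ a b d

Basic : ∀ {N U} {R : DBC N} → Path U R → ℕ → ℕ → Set
Basic ρ a b = ∀ j → a ℕ.< j → j ℕ.< b → pos ρ j ≢ pos ρ a

LbCorner : ∀ {N U} {R : DBC N} → Path U R → ℕ → ℕ → Set
LbCorner {N} ρ a b =
  (∃ λ d → HasExtent ρ a b d × (N ℕ.* N ℕ.< d)) × Basic ρ a b

-- Only the positions  f = pos ρ  along the path matter.  Every edge of an
-- unfolding changes the position by at most one, so f is a walk.  An lb-corner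
-- is then a tall excursion of f: a basic return [a, b] of f to its starting
-- level that somewhere lies more than K = N² away from that level.  Tallness is
-- decidable, so some tall excursion ends earliest; it is the only lb-corner
-- ending that early, since two excursions with the same end coincide.  Its
-- extent is K + 1: an excursion of a walk stays on one side of its base level,
-- and rising more than K + 1 above it would make the level one above the base
-- be crossed by a tall excursion ending earlier.  The case below the base
-- follows by negating the walk.
module Submission where

open import Defs
open import Data.Nat using (ℕ; suc; _*_; _≤_)
open import Data.Product using (∃; ∃₂; _×_)
open import Relation.Binary.PropositionalEquality using (_≡_)

open import Data.Nat using (_<_; z≤n; s≤s; _≤?_; _<?_)
import Data.Nat.Properties as NP
open import Data.Nat.Induction using (<-rec)
open import Data.Integer as Z using (ℤ; +_; -_)
import Data.Integer.Properties as ZP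
open import Data.Integer.Tactic.RingSolver using (solve-∀)
open import Data.Product using (_,_; proj₁; proj₂)
open import Data.Sum using (_⊎_; inj₁; inj₂)
open import Data.Empty using (⊥; ⊥-elim)
open import Data.Bool using (true; false)
open import Relation.Nullary using (Dec; yes; no; ¬_)
open import Relation.Nullary.Decidable using (_×-dec_; _⊎-dec_; _→-dec_; ¬?; map′)
open import Relation.Unary using (Decidable)
open import Relation.Binary.Definitions using (tri<; tri≈; tri>)
open import Relation.Binary.PropositionalEquality using (refl; sym; trans; cong; subst; subst₂; _≢_)
open import Function.Bundles using (_⇔_; mk⇔; Equivalence)
import Function.Properties.Equivalence as ⇔

open Z using () renaming (_+_ to _+ℤ_; _-_ to _-ℤ_; _≤_ to _≤ℤ_; _<_ to _<ℤ_)

least : ∀ {P : ℕ → Set} → Decidable P → ∀ {n} → P n →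
  ∃ λ m → m ≤ n × P m × (∀ k → k < m → ¬ P k)
least {P} P? {n} = <-rec Goal search n
  where
  Goal : ℕ → Set
  Goal n = P n → ∃ λ m → m ≤ n × P m × (∀ k → k < m → ¬ P k)
  search : ∀ n → (∀ {k} → k < n → Goal k) → Goal n
  search n earlier pn with NP.anyUpTo? P? n
  ... | no none = n , NP.≤-refl , pn , λ k k<n pk → none (k , k<n , pk)
  ... | yes (k , k<n , pk) with earlier k<n pk
  ...   | m , m≤k , pm , below = m , NP.≤-trans m≤k (NP.<⇒≤ k<n) , pm , below

greatest : ∀ {P : ℕ → Set} → Decidable P → ∀ {m} j → m ≤ j → P m →
  ∃ λ g → m ≤ g × g ≤ j × P g × (∀ k → g < k → k ≤ j → ¬ P k)
greatest {P} P? {m} j m≤j pm with P? j | NP.m≤n⇒m<n∨m≡n m≤j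
... | yes pj | _ = j , m≤j , NP.≤-refl , pj , λ k j<k k≤j _ → NP.<⇒≱ j<k k≤j
... | no ¬pj | inj₂ refl = ⊥-elim (¬pj pm)
greatest {P} P? (suc j) _ pm | no ¬pj | inj₁ (s≤s m≤j)
  with greatest P? j m≤j pm
... | g , m≤g , g≤j , pg , after = g , m≤g , NP.m≤n⇒m≤1+n g≤j , pg , after′
  where
  after′ : ∀ k → g < k → k ≤ suc j → ¬ P k
  after′ k g<k k≤1+j with NP.m≤n⇒m<n∨m≡n k≤1+j
  ... | inj₁ (s≤s k≤j) = after k g<k k≤j
  ... | inj₂ refl = ¬pj

Step1 : ℤ → ℤ → Set
Step1 x y = (y ≡ x) ⊎ (y ≡ x +ℤ + 1) ⊎ (x ≡ y +ℤ + 1)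

Walk : (ℕ → ℤ) → ℕ → Set
Walk f L = ∀ i → i < L → Step1 (f i) (f (suc i))

step-≤ : ∀ {x y h} → Step1 x y → x <ℤ h → y ≤ℤ h
step-≤ (inj₁ refl) x<h = ZP.<⇒≤ x<h
step-≤ {x} (inj₂ (inj₁ refl)) x<h = subst (_≤ℤ _) (ZP.+-comm (+ 1) x) (ZP.i<j⇒suc[i]≤j x<h)
step-≤ {x} {y} (inj₂ (inj₂ refl)) x<h = ZP.≤-trans (ZP.i≤i+j y (+ 1)) (ZP.<⇒≤ x<h)

ivt-up : ∀ {f L} → Walk f L → ∀ {h i j} → i ≤ j → j ≤ L →
  f i ≤ℤ h → h ≤ℤ f j → ∃ λ m → i ≤ m × m ≤ j × f m ≡ h
ivt-up walk {i = i} i≤j j≤L fi≤h h≤fj with NP.m≤n⇒m<n∨m≡n i≤j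
... | inj₂ refl = i , NP.≤-refl , NP.≤-refl , ZP.≤-antisym fi≤h h≤fj
ivt-up {f} walk {h} {j = suc j} _ j<L fi≤h h≤fj | inj₁ (s≤s i≤j) with h Z.≤? f j
... | yes h≤fj with ivt-up walk i≤j (NP.<⇒≤ j<L) fi≤h h≤fj
...   | m , i≤m , m≤j , fm≡h = m , i≤m , NP.m≤n⇒m≤1+n m≤j , fm≡h
ivt-up {f} walk {h} {j = suc j} _ j<L fi≤h h≤fj | inj₁ (s≤s i≤j) | no h≰fj =
  suc j , NP.m≤n⇒m≤1+n i≤j , NP.≤-refl ,
  ZP.≤-antisym (step-≤ (walk j j<L) (ZP.≰⇒> h≰fj)) h≤fj

neg-suc : ∀ x → - x ≡ - (x +ℤ + 1) +ℤ + 1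
neg-suc = solve-∀

step-neg : ∀ {x y} → Step1 x y → Step1 (- x) (- y)
step-neg (inj₁ refl) = inj₁ refl
step-neg {x} (inj₂ (inj₁ refl)) = inj₂ (inj₂ (neg-suc x))
step-neg {x} {y} (inj₂ (inj₂ refl)) = inj₂ (inj₁ (neg-suc y))

walk-neg : ∀ {f L} → Walk f L → Walk (λ k → - f k) L
walk-neg walk i i<L = step-neg (walk i i<L)

ivt-down : ∀ {f L} → Walk f L → ∀ {h i j} → i ≤ j → j ≤ L →
  h ≤ℤ f i → f j ≤ℤ h → ∃ λ m → i ≤ m × m ≤ j × f m ≡ h
ivt-down walk i≤j j≤L h≤fi fj≤h
  with ivt-up (walk-neg walk) i≤j j≤L (ZP.neg-mono-≤ h≤fi) (ZP.neg-mono-≤ fj≤h)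
... | m , i≤m , m≤j , e = m , i≤m , m≤j , ZP.neg-injective e

Excursion : (ℕ → ℤ) → ℕ → ℕ → Set
Excursion f a b = (a < b) × (f a ≡ f b) × (∀ j → a < j → j < b → f j ≢ f a)

-- Two excursions ending at the same point coincide: the later start would be
-- an interior return of the earlier excursion.
excursion-start-unique : ∀ {f a a′ b} → Excursion f a b → Excursion f a′ b → a′ ≡ a
excursion-start-unique {a = a} {a′} (a<b , fa≡fb , basic) (a′<b , fa′≡fb , basic′)
  with NP.<-cmp a′ a
... | tri< a′<a _ _ = ⊥-elim (basic′ a a′<a a<b (trans fa≡fb (sym fa′≡fb)))
... | tri≈ _ a′≡a _ = a′≡a
... | tri> _ _ a<a′ = ⊥-elim (basic a′ a<a′ a′<b (trans fa′≡fb (sym fa≡fb)))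

-- The interior of an excursion of a walk lies strictly on one side of the
-- base level: a point on each side would force a return in between.
excursion-side : ∀ {f L a b} → Walk f L → b ≤ L → Excursion f a b →
  ∀ {j m} → a < j → j < b → a < m → m < b → f a <ℤ f j → f a <ℤ f m
excursion-side {f} {a = a} walk b≤L (_ , _ , basic) {j} {m} a<j j<b a<m m<b fa<fj
  with ZP.<-cmp (f a) (f m)
... | tri< fa<fm _ _ = fa<fm
... | tri≈ _ fa≡fm _ = ⊥-elim (basic m a<m m<b (sym fa≡fm))
... | tri> _ _ fm<fa = ⊥-elim (return (NP.≤-total m j))
  where
  return : m ≤ j ⊎ j ≤ m → ⊥
  return (inj₁ m≤j)
    with ivt-up walk m≤j (NP.≤-trans (NP.<⇒≤ j<b) b≤L) (ZP.<⇒≤ fm<fa) (ZP.<⇒≤ fa<fj)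
  ... | t , m≤t , t≤j , ft≡fa = basic t (NP.<-≤-trans a<m m≤t) (NP.≤-<-trans t≤j j<b) ft≡fa
  return (inj₂ j≤m)
    with ivt-down walk j≤m (NP.≤-trans (NP.<⇒≤ m<b) b≤L) (ZP.<⇒≤ fa<fj) (ZP.<⇒≤ fm<fa)
  ... | t , j≤t , t≤m , ft≡fa = basic t (NP.<-≤-trans a<j j≤t) (NP.≤-<-trans t≤m m<b) ft≡fa

-- A walk that is below a level h at a and at b but above it at m in between
-- crosses h by an excursion enclosing m: from its last visit to h before m
-- to its first visit to h after m.
inner-excursion : ∀ {f L a m b h} → Walk f L → a ≤ m → m ≤ b → b ≤ L →
  f a <ℤ h → h <ℤ f m → f b <ℤ h →
  ∃₂ λ i j → a ≤ i × i < m × m < j × j < b × f i ≡ h × Excursion f i j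
inner-excursion {f} {m = m} {b} {h} walk a≤m m≤b b≤L fa<h h<fm fb<h
  with ivt-up walk a≤m (NP.≤-trans m≤b b≤L) (ZP.<⇒≤ fa<h) (ZP.<⇒≤ h<fm)
     | ivt-down walk m≤b b≤L (ZP.<⇒≤ h<fm) (ZP.<⇒≤ fb<h)
... | up , a≤up , up≤m , fup≡h | down , m≤down , down≤b , fdown≡h
  with greatest (λ k → f k Z.≟ h) m up≤m fup≡h
     | least (λ k → (m ≤? k) ×-dec (f k Z.≟ h)) (m≤down , fdown≡h)
... | i , up≤i , i≤m , fi≡h , after | j , j≤down , (m≤j , fj≡h) , before =
  i , j , NP.≤-trans a≤up up≤i , i<m , m<j , j<b , fi≡h ,
  (NP.<-trans i<m m<j , trans fi≡h (sym fj≡h) , basic)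
  where
  i<m : i < m
  i<m = NP.≤∧≢⇒< i≤m (λ i≡m → ZP.<-irrefl (trans (sym fi≡h) (cong f i≡m)) h<fm)
  m<j : m < j
  m<j = NP.≤∧≢⇒< m≤j (λ m≡j → ZP.<-irrefl (trans (sym fj≡h) (cong f (sym m≡j))) h<fm)
  j<b : j < b
  j<b = NP.≤∧≢⇒< (NP.≤-trans j≤down down≤b)
          (λ j≡b → ZP.<-irrefl (trans (cong f (sym j≡b)) fj≡h) fb<h)
  basic : ∀ k → i < k → k < j → f k ≢ f i
  basic k i<k k<j fk≡fi with k ≤? m
  ... | yes k≤m = after k i<k k≤m (trans fk≡fi fi≡h)
  ... | no k≰m = before k k<j (NP.<⇒≤ (NP.≰⇒> k≰m) , trans fk≡fi fi≡h)

Far : ℕ → ℤ → ℤ → Set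
Far K x y = (x +ℤ + suc K ≤ℤ y) ⊎ (y +ℤ + suc K ≤ℤ x)

Tall : ℕ → ℕ → (ℕ → ℤ) → ℕ → ℕ → Set
Tall K L f a b = (b ≤ L) × Excursion f a b × (∃ λ j → a ≤ j × j ≤ b × Far K (f a) (f j))

tall? : ∀ K L f a b → Dec (Tall K L f a b)
tall? K L f a b = (b ≤? L) ×-dec ((a <? b) ×-dec (f a Z.≟ f b) ×-dec basic?) ×-dec far?
  where
  basic? : Dec (∀ j → a < j → j < b → f j ≢ f a)
  basic? = map′ (λ all j a<j j<b → all j<b a<j) (λ basic {j} j<b a<j → basic j a<j j<b)
                (NP.allUpTo? (λ j → (a <? j) →-dec ¬? (f j Z.≟ f a)) b)
  far? : Dec (∃ λ j → a ≤ j × j ≤ b × Far K (f a) (f j))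
  far? = map′ (λ { (j , s≤s j≤b , a≤j , far) → j , a≤j , j≤b , far })
              (λ { (j , a≤j , j≤b , far) → j , s≤s j≤b , a≤j , far })
              (NP.anyUpTo? (λ j → (a ≤? j) ×-dec
                 ((f a +ℤ + suc K Z.≤? f j) ⊎-dec (f j +ℤ + suc K Z.≤? f a))) (suc b))

NoTallBefore : ℕ → ℕ → (ℕ → ℤ) → ℕ → Set
NoTallBefore K L f b = ∀ a′ b′ → b′ < b → ¬ Tall K L f a′ b′

tall-start<end : ∀ {K L f a b} → Tall K L f a b → a < b
tall-start<end (_ , (a<b , _) , _) = a<b

earliest-tall : ∀ {K L f} → (∃₂ λ a b → Tall K L f a b) →
  ∃₂ λ a b → Tall K L f a b × NoTallBefore K L f b
earliest-tall {K} {L} {f} (a₀ , b₀ , tall₀)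
  with least (λ b → NP.anyUpTo? (λ a → tall? K L f a b) b)
             (a₀ , tall-start<end tall₀ , tall₀)
... | b , _ , (a , _ , tall) , earlier =
  a , b , tall , λ a′ b′ b′<b tall′ → earlier b′ b′<b (a′ , tall-start<end tall′ , tall′)

next-level : ∀ x s {y} → x +ℤ s <ℤ y → (x +ℤ + 1) +ℤ s ≤ℤ y
next-level x s x+s<y = subst (_≤ℤ _) (regroup x s) (ZP.i<j⇒suc[i]≤j x+s<y)
  where
  regroup : ∀ x s → + 1 +ℤ (x +ℤ s) ≡ (x +ℤ + 1) +ℤ s
  regroup = solve-∀

Attains : (ℕ → ℤ) → ℕ → ℕ → ℤ → Set
Attains f a b k = ∃ λ m → a ≤ m × m ≤ b × f m ≡ k

<+suc : ∀ x K → x <ℤ x +ℤ + suc K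
<+suc x K = subst (_<ℤ x +ℤ + suc K) (ZP.+-identityʳ x) (ZP.+-monoʳ-< x (Z.+<+ (s≤s z≤n)))

module _ {K L : ℕ} {f : ℕ → ℤ} (walk : Walk f L) {a b : ℕ} (b≤L : b ≤ L)
         (excursion : Excursion f a b) (first : NoTallBefore K L f b)
         {j : ℕ} (a≤j : a ≤ j) (j≤b : j ≤ b) (high : f a +ℤ + suc K ≤ℤ f j) where

  private
    fa≡fb : f a ≡ f b
    fa≡fb = proj₁ (proj₂ excursion)

    fa<fj : f a <ℤ f j
    fa<fj = ZP.<-≤-trans (<+suc (f a) K) high

    a<j : a < j
    a<j = NP.≤∧≢⇒< a≤j (λ a≡j → ZP.<-irrefl (cong f a≡j) fa<fj)

    j<b : j < b
    j<b = NP.≤∧≢⇒< j≤b (λ j≡b → ZP.<-irrefl (trans fa≡fb (cong f (sym j≡b))) fa<fj)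

  -- The excursion never goes below its base level (it is above it at j).
  floor : ∀ {m} → a ≤ m → m ≤ b → f a ≤ℤ f m
  floor a≤m m≤b with NP.m≤n⇒m<n∨m≡n a≤m | NP.m≤n⇒m<n∨m≡n m≤b
  ... | inj₂ refl | _ = ZP.≤-refl
  ... | inj₁ _ | inj₂ refl = ZP.≤-reflexive fa≡fb
  ... | inj₁ a<m | inj₁ m<b = ZP.<⇒≤ (excursion-side walk b≤L excursion a<j j<b a<m m<b fa<fj)

  -- The excursion never goes more than K + 1 above its base level: otherwise
  -- the level f a + 1 would be crossed by a tall excursion ending before b.
  no-overshoot : ∀ {m} → a ≤ m → m ≤ b → ¬ (f a +ℤ + suc K <ℤ f m)
  no-overshoot {m} a≤m m≤b overshoot
    with inner-excursion walk a≤m m≤b b≤L fa<h h<fm (subst (_<ℤ h) fa≡fb fa<h)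
    where
    h : ℤ
    h = f a +ℤ + 1
    fa<h : f a <ℤ h
    fa<h = <+suc (f a) 0
    h<fm : h <ℤ f m
    h<fm = ZP.≤-<-trans (ZP.+-monoʳ-≤ (f a) (Z.+≤+ (s≤s z≤n))) overshoot
  ... | i , j′ , _ , i<m , m<j′ , j′<b , fi≡h , inner =
    first i j′ j′<b (NP.≤-trans (NP.<⇒≤ j′<b) b≤L , inner ,
                     m , NP.<⇒≤ i<m , NP.<⇒≤ m<j′ , inj₁ far)
    where
    far : f i +ℤ + suc K ≤ℤ f m
    far = subst (λ x → x +ℤ + suc K ≤ℤ f m) (sym fi≡h) (next-level (f a) (+ suc K) overshoot)

  ceiling : ∀ {m} → a ≤ m → m ≤ b → f m ≤ℤ f a +ℤ + suc K
  ceiling a≤m m≤b = ZP.≮⇒≥ (no-overshoot a≤m m≤b)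

  -- The values on [a, b] are exactly the levels f a, …, f a + K + 1: floor and
  -- ceiling bound them, and the rise from a to j passes through all of them.
  height-above : ∀ k → Attains f a b k ⇔ ((f a ≤ℤ k) × (k ≤ℤ f a +ℤ + suc K))
  height-above k = mk⇔ range fill
    where
    range : Attains f a b k → (f a ≤ℤ k) × (k ≤ℤ f a +ℤ + suc K)
    range (m , a≤m , m≤b , refl) = floor a≤m m≤b , ceiling a≤m m≤b
    fill : (f a ≤ℤ k) × (k ≤ℤ f a +ℤ + suc K) → Attains f a b k
    fill (fa≤k , k≤top) with ivt-up walk a≤j (NP.≤-trans j≤b b≤L) fa≤k (ZP.≤-trans k≤top high)
    ... | t , a≤t , t≤j , ft≡k = t , a≤t , NP.≤-trans t≤j j≤b , ft≡k

-- Reflection: negating the walk exchanges excursions above and below the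
-- base level, so the case of an excursion below reduces to the one above.

shift-neg : ∀ {x s y} → x +ℤ s ≤ℤ y → - y +ℤ s ≤ℤ - x
shift-neg {x} {s} {y} x+s≤y =
  subst (- y +ℤ s ≤ℤ_) (cancel x s) (ZP.+-monoˡ-≤ s (ZP.neg-mono-≤ x+s≤y))
  where
  cancel : ∀ x s → - (x +ℤ s) +ℤ s ≡ - x
  cancel = solve-∀

far-neg : ∀ {K x y} → Far K x y → Far K (- x) (- y)
far-neg (inj₁ above) = inj₂ (shift-neg above)
far-neg (inj₂ below) = inj₁ (shift-neg below)

excursion-neg : ∀ {f a b} → Excursion f a b → Excursion (λ k → - f k) a b
excursion-neg (a<b , fa≡fb , basic) =
  a<b , cong -_ fa≡fb , λ j a<j j<b e → basic j a<j j<b (ZP.neg-injective e)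

excursion-unneg : ∀ {f a b} → Excursion (λ k → - f k) a b → Excursion f a b
excursion-unneg (a<b , fa≡fb , basic) =
  a<b , ZP.neg-injective fa≡fb , λ j a<j j<b e → basic j a<j j<b (cong -_ e)

tall-unneg : ∀ {K L f a b} → Tall K L (λ k → - f k) a b → Tall K L f a b
tall-unneg {K} {f = f} {a} (b≤L , excursion , j , a≤j , j≤b , far) =
  b≤L , excursion-unneg excursion , j , a≤j , j≤b ,
  subst₂ (Far K) (ZP.neg-involutive (f a)) (ZP.neg-involutive (f j)) (far-neg far)

attains-neg : ∀ {f a b k} → Attains (λ i → - f i) a b (- k) ⇔ Attains f a b k
attains-neg = mk⇔ (λ (m , a≤m , m≤b , e) → m , a≤m , m≤b , ZP.neg-injective e)
                  (λ (m , a≤m , m≤b , e) → m , a≤m , m≤b , cong -_ e)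

reflect-interval : ∀ x s k →
  ((- x ≤ℤ - k) × (- k ≤ℤ - x +ℤ s)) ⇔ ((x -ℤ s ≤ℤ k) × (k ≤ℤ x))
reflect-interval x s k = mk⇔
  (λ (-x≤-k , -k≤top) → ZP.neg-cancel-≤ (subst (- k ≤ℤ_) (reflect x s) -k≤top) ,
                         ZP.neg-cancel-≤ -x≤-k)
  (λ (bottom≤k , k≤x) → ZP.neg-mono-≤ k≤x ,
                         subst (- k ≤ℤ_) (sym (reflect x s)) (ZP.neg-mono-≤ bottom≤k))
  where
  reflect : ∀ x s → - x +ℤ s ≡ - (x -ℤ s)
  reflect = solve-∀

height-below : ∀ {K L f a b j} → Walk f L → b ≤ L → Excursion f a b →
  NoTallBefore K L f b → a ≤ j → j ≤ b → f j +ℤ + suc K ≤ℤ f a →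
  ∀ k → Attains f a b k ⇔ ((f a -ℤ + suc K ≤ℤ k) × (k ≤ℤ f a))
height-below {K} {L} {f} {a} {b} walk b≤L excursion first a≤j j≤b low k =
  ⇔.trans (⇔.sym attains-neg)
    (⇔.trans (height-above (walk-neg walk) b≤L (excursion-neg excursion) first-neg
                           a≤j j≤b (shift-neg low) (- k))
             (reflect-interval (f a) (+ suc K) k))
  where
  first-neg : NoTallBefore K L (λ i → - f i) b
  first-neg a′ b′ b′<b tall = first a′ b′ b′<b (tall-unneg tall)

place-step : ∀ {N} (t t′ : Term N) p {u v : Vertex N} → place t p ≡ u → place t′ p ≡ v →
  Step1 (position u) (position v)
place-step (_ , false) (_ , false) p refl refl = inj₁ refl
place-step (_ , false) (_ , true)  p refl refl = inj₂ (inj₁ refl)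
place-step (_ , true)  (_ , false) p refl refl = inj₂ (inj₂ refl)
place-step (_ , true)  (_ , true)  p refl refl = inj₁ refl

far-right : ∀ {K d} x y → K < d → y ≡ x +ℤ + d → Far K x y
far-right x y K<d refl = inj₁ (ZP.+-monoʳ-≤ x (Z.+≤+ K<d))

far-left : ∀ {K d} x y → K < d → y ≡ x -ℤ + d → Far K x y
far-left {K} {d} x y K<d refl =
  inj₂ (subst ((x -ℤ + d) +ℤ + suc K ≤ℤ_) (restore x (+ d)) (ZP.+-monoʳ-≤ (x -ℤ + d) (Z.+≤+ K<d)))
  where
  restore : ∀ x d → (x -ℤ d) +ℤ d ≡ x
  restore = solve-∀

module _ {N : ℕ} {R : DBC N} {U : Unfolding} (ρ : Path U R) where

  path-walk : Walk (pos ρ) (len ρ)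
  path-walk i i<len with step ρ i i<len
  ... | p , _ , e , _ , lhs≡ , rhs≡ , _ = place-step (lhs e) (rhs e) p lhs≡ rhs≡

  lb→tall : ∀ {a b} → LbCorner ρ a b → Tall (N * N) (len ρ) (pos ρ) a b
  lb→tall {a} ((d , inj₁ ((a<b , b≤L , e) , positions) , N²<d) , basic)
    with Equivalence.from (positions (pos ρ a +ℤ + d)) (ZP.i≤i+j (pos ρ a) (+ d) , ZP.≤-refl)
  ... | j , a≤j , j≤b , fj≡ = b≤L , (a<b , e , basic) , j , a≤j , j≤b , far-right _ _ N²<d fj≡
  lb→tall {a} ((d , inj₂ ((a<b , b≤L , e) , positions) , N²<d) , basic)
    with Equivalence.from (positions (pos ρ a -ℤ + d)) (ZP.≤-refl , ZP.i≤j⇒i-k≤j (+ d) ZP.≤-refl)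
  ... | j , a≤j , j≤b , fj≡ = b≤L , (a<b , e , basic) , j , a≤j , j≤b , far-left _ _ N²<d fj≡

  earliest-extent : ∀ {a b} → Tall (N * N) (len ρ) (pos ρ) a b →
    NoTallBefore (N * N) (len ρ) (pos ρ) b → HasExtent ρ a b (suc (N * N))
  earliest-extent (b≤L , excursion@(a<b , e , _) , j , a≤j , j≤b , inj₁ high) first =
    inj₁ ((a<b , b≤L , e) , height-above path-walk b≤L excursion first a≤j j≤b high)
  earliest-extent (b≤L , excursion@(a<b , e , _) , j , a≤j , j≤b , inj₂ low) first =
    inj₂ ((a<b , b≤L , e) , height-below path-walk b≤L excursion first a≤j j≤b low)

  earliest-unique : ∀ {a b} → Tall (N * N) (len ρ) (pos ρ) a b →
    NoTallBefore (N * N) (len ρ) (pos ρ) b →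
    ∀ a′ b′ → b′ ≤ b → LbCorner ρ a′ b′ → (a′ ≡ a) × (b′ ≡ b)
  earliest-unique (_ , excursion , _) first a′ b′ b′≤b lb with NP.m≤n⇒m<n∨m≡n b′≤b
  ... | inj₁ b′<b = ⊥-elim (first a′ b′ b′<b (lb→tall lb))
  ... | inj₂ refl = excursion-start-unique excursion (proj₁ (proj₂ (lb→tall lb))) , refl

proposition4 : (N : ℕ) (R : DBC N) → Balanced R →
    (U : Unfolding) (ρ : Path U R) →
    (∃₂ λ a b → LbCorner ρ a b) →
    ∃₂ λ a b → (a ≤ b) × (b ≤ len ρ) ×
      (∀ a′ b′ → b′ ≤ b → LbCorner ρ a′ b′ → (a′ ≡ a) × (b′ ≡ b)) ×
      LbCorner ρ a b × HasExtent ρ a b (suc (N * N))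
proposition4 N R _ U ρ (a₀ , b₀ , lb₀) with earliest-tall (a₀ , b₀ , lb→tall ρ lb₀)
... | a , b , tall@(b≤L , (a<b , _ , basic) , _) , first =
  a , b , NP.<⇒≤ a<b , b≤L , earliest-unique ρ tall first ,
  ((suc (N * N) , extent , NP.≤-refl) , basic) , extent
  where
  extent : HasExtent ρ a b (suc (N * N))
  extent = earliest-extent ρ tall first
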